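{- Let $S$ be a positive semifield. The assignment $X\mapsto\mathcal C_f(X)$ gives a monad on Set whose action on functions, unit and multiplication are those of $\mathcal C$ (restricted/corestricted): i.e. $\mathcal C(f)$ maps $\mathcal C_fX$ into $\mathcal C_fY$ for every $f\colon X\to Y$, $\eta^{\mathcal C}_X$ lands in $\mathcal C_fX$, and $\mu^{\mathcal C}_X$ maps $\mathcal C_f\mathcal C_fX$ into $\mathcal C_fX$.
   Context: $S$ positive: $a+b=0\Rightarrow a=b=0$; semifield: nonzero elements invertible. $\mathcal SX$: finitely supported $\phi\colon X\to S$; $\mathcal S(f)(\phi)(y)=\sum_{x\in f^{ -1}\{y\}}\phi(x)$; $\mu^{\mathcal S}_X(\Psi)(x)=\sum_{\phi\in\mathrm{supp}\Psi}\Psi(\phi)\phi(x)$. For $\mathcal B\subseteq\mathcal SX$, $\mathrm{conv}(\mathcal B)=\{\mu^{\mathcal S}_X(\Psi)\mid\mathrm{supp}\Psi\subseteq\mathcal B,\ \sum\Psi(\phi)=1\}$. The monad $\mathcal C$: $\mathcal CX=\{\mathcal A\subseteq\mathcal SX\mid\mathcal A=\mathrm{conv}(\mathcal A)\}$; $\mathcal C(f)(\mathcal A)=\{\mathcal S(f)(\Phi)\mid\Phi\in\mathcal A\}$; $\eta^{\mathcal C}_X(x)=\{\Delta_x\}$; $\mu^{\mathcal C}_X(\mathscr A)=\bigcup_{\Omega\in\mathscr A}\{\mu^{\mathcal S}_X(\Psi)\mid\Psi\in c(\Omega)\}$ with $c(\Omega)$ the set of $\chi_u(\phi)=\sum_{\mathcal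 A\in\mathrm{supp}\Omega,\,u(\mathcal A)=\phi}\Omega(\mathcal A)$ over $u\colon\mathrm{supp}\Omega\to\mathcal SX$ with $u(\mathcal A)\in\mathcal A$. $\mathcal C_fX$ is the set of $\mathcal A\in\mathcal CX$ that are finitely generated: $\mathcal A=\mathrm{conv}(\mathcal B)$ for some finite $\mathcal B\subseteq\mathcal SX$. -}

module Defs where

open import Level using (Level; _⊔_; suc)
open import Algebra.Bundles using (CommutativeSemiring)
open import Relation.Binary.Bundles using (Setoid)
open import Relation.Binary.Structures using (IsEquivalence)
open import Function.Bundles using (Func; _⇔_)
open import Data.List using (List; []; _∷_; foldr; map)
open import Data.List.Relation.Unary.Any using (Any)
open import Data.List.Relation.Unary.AllPairs using (AllPairs)
open import Data.Product using (Σ; ∃; ∃-syntax; Σ-syntax; _×_; _,_; proj₁; proj₂)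
open import Relation.Nullary using (¬_)

IsPositive : ∀ {c ℓ} → CommutativeSemiring c ℓ → Set (c ⊔ ℓ)
IsPositive S = ∀ a b → a + b ≈ 0# → (a ≈ 0#) × (b ≈ 0#)
  where open CommutativeSemiring S

IsSemifield : ∀ {c ℓ} → CommutativeSemiring c ℓ → Set (c ⊔ ℓ)
IsSemifield S = ∀ x → ¬ (x ≈ 0#) → ∃[ y ] (x * y ≈ 1#)
  where open CommutativeSemiring S

module _ {c ℓ} (S : CommutativeSemiring c ℓ) where
  open CommutativeSemiring S renaming (Carrier to K)

  Σ-list : List K → K
  Σ-list = foldr _+_ 0#

  -- SumWhere L P g t :  t = Σ_{x ∈ L, P x} g x   (relational, no decidability needed)
  data SumWhere {a p} {A : Set a} (P : A → Set p) (g : A → K)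
       : List A → K → Set (a ⊔ p ⊔ c ⊔ ℓ) where
    nil  : ∀ {t} → t ≈ 0# → SumWhere P g [] t
    here : ∀ {x L s t} → P x → SumWhere P g L s → t ≈ g x + s
         → SumWhere P g (x ∷ L) t
    skip : ∀ {x L t} → ¬ P x → SumWhere P g L t → SumWhere P g (x ∷ L) t

  -- 𝒮X : finitely supported functions X → S.  The field `support` is a
  -- duplicate-free (up to ≈) list containing the support {x | φ x ≠ 0}.
  record FS {a e} (X : Setoid a e) : Set (a ⊔ e ⊔ c ⊔ ℓ) where
    open Setoid X renaming (Carrier to |X|; _≈_ to _≈X_)
    field
      fun      : |X| → K
      resp     : ∀ {x y} → x ≈X y → fun x ≈ fun y
      support  : List |X|
      distinct : AllPairs (λ x y → ¬ (x ≈X y)) support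
      covers   : ∀ x → ¬ (fun x ≈ 0#) → Any (x ≈X_) support
  open FS public

  𝒮 : ∀ {a e} → Setoid a e → Setoid (a ⊔ e ⊔ c ⊔ ℓ) (a ⊔ ℓ)
  𝒮 X = record
    { Carrier = FS X
    ; _≈_ = λ φ ψ → ∀ x → fun φ x ≈ fun ψ x
    ; isEquivalence = record
      { refl = λ x → refl
      ; sym = λ p x → sym (p x)
      ; trans = λ p q x → trans (p x) (q x) } }

  total : ∀ {a e} {X : Setoid a e} → FS X → K
  total φ = Σ-list (map (fun φ) (support φ))

  module _ {a e} (X : Setoid a e) where
    open Setoid X renaming (Carrier to |X|; _≈_ to _≈X_)
    open Setoid (𝒮 X) using () renaming (_≈_ to _≈S_)

    IsMuS : FS (𝒮 X) → FS X → Set (a ⊔ ℓ)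
    IsMuS Ψ φ = ∀ x → fun φ x ≈ Σ-list (map (λ χ → fun Ψ χ * fun χ x) (support Ψ))

    conv : ∀ {p} → (FS X → Set p) → FS X → Set (a ⊔ e ⊔ c ⊔ ℓ ⊔ p)
    conv B φ = Σ[ Ψ ∈ FS (𝒮 X) ] ((∀ χ → ¬ (fun Ψ χ ≈ 0#) → B χ) × (total Ψ ≈ 1#) × IsMuS Ψ φ)

    record CSet : Set (suc (a ⊔ e ⊔ c ⊔ ℓ)) where
      field
        pred   : FS X → Set (a ⊔ e ⊔ c ⊔ ℓ)
        closed : ∀ φ → pred φ ⇔ conv pred φ
    open CSet public

    IsFinGen : CSet → Set (a ⊔ e ⊔ c ⊔ ℓ)
    IsFinGen A = Σ[ B ∈ List (FS X) ] (∀ φ → pred A φ ⇔ conv (λ χ → Any (χ ≈S_) B) φ)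

    -- η^𝒞_X(x) = {Δ_x}; "φ = Δ_x"
    IsDelta : |X| → FS X → Set (a ⊔ e ⊔ ℓ)
    IsDelta x φ = (∀ y → y ≈X x → fun φ y ≈ 1#) × (∀ y → ¬ (y ≈X x) → fun φ y ≈ 0#)

  𝒞 : ∀ {a e} → Setoid a e → Setoid (suc (a ⊔ e ⊔ c ⊔ ℓ)) (a ⊔ e ⊔ c ⊔ ℓ)
  𝒞 X = record
    { Carrier = CSet X
    ; _≈_ = λ A B → ∀ φ → (pred A φ → pred B φ) × (pred B φ → pred A φ)
    ; isEquivalence = record
      { refl = λ φ → (λ z → z) , (λ z → z)
      ; sym = λ p φ → proj₂ (p φ) , proj₁ (p φ)
      ; trans = λ p q φ → (λ z → proj₁ (q φ) (proj₁ (p φ) z))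
                        , (λ z → proj₂ (p φ) (proj₂ (q φ) z)) } }

  𝒞f : ∀ {a e} → Setoid a e → Setoid (suc (a ⊔ e ⊔ c ⊔ ℓ)) (a ⊔ e ⊔ c ⊔ ℓ)
  𝒞f X = record
    { Carrier = Σ (CSet X) (IsFinGen X)
    ; _≈_ = λ A B → proj₁ A ≈C proj₁ B
    ; isEquivalence = record
      { refl = λ {A} → C.refl {proj₁ A}
      ; sym = λ {A} {B} → C.sym {proj₁ A} {proj₁ B}
      ; trans = λ {A} {B} {C} → C.trans {proj₁ A} {proj₁ B} {proj₁ C} } }
    where module C = Setoid (𝒞 X)
          _≈C_ = C._≈_

  IsPush : ∀ {a e} {X Y : Setoid a e} → Func X Y → FS X → FS Y → Set (a ⊔ e ⊔ c ⊔ ℓ)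
  IsPush {Y = Y} f φ ψ =
    ∀ y → SumWhere (λ x → Func.to f x ≈Y y) (fun φ) (support φ) (fun ψ y)
    where open Setoid Y renaming (_≈_ to _≈Y_)

  CImage : ∀ {a e} {X Y : Setoid a e} → Func X Y → CSet X → FS Y → Set (a ⊔ e ⊔ c ⊔ ℓ)
  CImage f A ψ = Σ[ Φ ∈ FS _ ] (pred A Φ × IsPush f Φ ψ)

  -- μ^𝒞, for Ω ∈ 𝒮Z where each z ∈ Z denotes a subset ⟦ z ⟧ ⊆ 𝒮X
  -- (Z = 𝒞X with ⟦_⟧ = pred gives μ^𝒞_X; Z = 𝒞_f X gives its restriction).
  module _ {a e z ez} (X : Setoid a e) (Z : Setoid z ez)
           (⟦_⟧ : Setoid.Carrier Z → FS X → Set (a ⊔ e ⊔ c ⊔ ℓ)) where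
    open Setoid (𝒮 X) using () renaming (_≈_ to _≈S_)

    InC : FS Z → FS (𝒮 X) → Set (a ⊔ e ⊔ c ⊔ ℓ ⊔ z)
    InC Ω Ψ = Σ[ u ∈ (Setoid.Carrier Z → FS X) ] ((∀ A → ¬ (fun Ω A ≈ 0#) → ⟦ A ⟧ (u A))
                     × (∀ φ → SumWhere (λ A → u A ≈S φ) (fun Ω) (support Ω) (fun Ψ φ)))

    MuC : CSet Z → FS X → Set (a ⊔ e ⊔ c ⊔ ℓ ⊔ z ⊔ ez)
    MuC 𝒜 φ = Σ[ Ω ∈ FS Z ] (pred 𝒜 Ω × Σ[ Ψ ∈ FS (𝒮 X) ] (InC Ω Ψ × IsMuS X Ψ φ))

{-# OPTIONS --safe #-}
-- Sets are handled through explicit convex combinations: weights summing to 1 attached to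
-- finitely supported functions. The pairing ⟪ φ , h ⟫ = Σₓ φ(x) h(x) is linear in φ, and 𝒮(f),
-- totals and μ^𝒮 are all pairings; hence 𝒞(f)(conv G) = conv (𝒮(f) G) and η(x) = conv {Δₓ}.
-- For 𝒜 = conv 𝔊 in 𝒞_f 𝒞_f X, μ(𝒜) is generated by the finitely many sums Σ_A Ω(A) g_A with
-- Ω ∈ 𝔊 and g_A a generator of A. One inclusion writes Ω = Σ_q w_q Ω_q over 𝔊 and expands every
-- u(A) ∈ A over the generators of A, a Minkowski sum of convex combinations; positivity and
-- inverses give supp Ω_q ⊆ supp Ω. Conversely, from Σ_d w_d Σ_A Ω_d(A) g^d_A take
-- Ω = Σ_d w_d Ω_d ∈ 𝒜 and u(A) = Σ_d w_d Ω_d(A) g^d_A / Ω(A), which lies in A by convexity;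
-- positivity makes Ω(A) = 0 force w_d Ω_d(A) = 0 for every d.

module Submission where

open import Defs
open import Level using (Level; _⊔_)
open import Algebra.Bundles using (CommutativeSemiring)
open import Relation.Binary.Bundles using (Setoid; DecSetoid)
open import Relation.Binary.Definitions using (Decidable; _Respects_)
import Relation.Unary as U
open import Function.Base using (_∘_; id)
open import Function.Definitions using (Congruent)
open import Function.Bundles using (Func; _⇔_; mk⇔; Equivalence)
open import Data.Product using (Σ-syntax; _×_; _,_; proj₁; proj₂)
open import Data.Sum using (inj₁; inj₂)
open import Data.List using (List; []; _∷_; _++_; map; concatMap; filter; deduplicate)
open import Data.List.Properties using (map-∘)
open import Data.List.Relation.Unary.Any using (Any; here; there)
import Data.List.Relation.Unary.Any as Any
import Data.List.Relation.Unary.Any.Properties as Anyₚ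
open import Data.List.Relation.Unary.All using (All; []; _∷_)
import Data.List.Relation.Unary.All as All
import Data.List.Relation.Unary.All.Properties as Allₚ
open import Data.List.Relation.Unary.AllPairs using (AllPairs; []; _∷_)
open import Data.List.Relation.Unary.Unique.DecSetoid.Properties using (deduplicate-!)
import Data.List.Relation.Unary.AllPairs.Properties as AllPairs
open import Data.List.Membership.Propositional using (_∈_; find)
open import Relation.Nullary using (¬_; Dec; yes; no)
open import Data.Empty using (⊥-elim)
open import Relation.Binary.PropositionalEquality as ≡ using (_≡_)
open import Axiom.ExcludedMiddle using (ExcludedMiddle)

module FiniteConvexSets {c ℓ} (S : CommutativeSemiring c ℓ) (em : ∀ {p} → ExcludedMiddle p) where
  open CommutativeSemiring S renaming (Carrier to K)
  open import Algebra.Properties.CommutativeSemigroup +-commutativeSemigroup using () renaming (interchange to +-interchange)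
  open import Algebra.Properties.CommutativeSemigroup *-commutativeSemigroup using (x∙yz≈y∙xz)
  open import Algebra.Solver.Ring.NaturalCoefficients.Default S using (solve; _:*_; _:+_; _:=_; con)
  open import Relation.Binary.Reasoning.Setoid setoid

  -- Finite sums

  private variable
    a b : Level
    A : Set a
    B : Set b

  ∑ : (A → K) → List A → K
  ∑ f L = Σ-list S (map f L)

  ∑-map : ∀ (f : B → K) (g : A → B) L → ∑ f (map g L) ≡ ∑ (f ∘ g) L
  ∑-map f g L = ≡.cong (Σ-list S) (≡.sym (map-∘ L))

  ∑-congᴬ : ∀ {f g : A → K} {L} → All (λ x → f x ≈ g x) L → ∑ f L ≈ ∑ g L
  ∑-congᴬ [] = refl
  ∑-congᴬ (e ∷ es) = +-cong e (∑-congᴬ es)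

  ∑-cong : ∀ {f g : A → K} → (∀ x → f x ≈ g x) → ∀ L → ∑ f L ≈ ∑ g L
  ∑-cong e L = ∑-congᴬ (All.universal e L)

  ∑-zero : ∀ {f : A → K} {L} → All (λ x → f x ≈ 0#) L → ∑ f L ≈ 0#
  ∑-zero [] = refl
  ∑-zero (z ∷ zs) = trans (+-cong z (∑-zero zs)) (+-identityˡ 0#)

  ∑-+ : ∀ (f g : A → K) L → ∑ (λ x → f x + g x) L ≈ ∑ f L + ∑ g L
  ∑-+ f g [] = sym (+-identityˡ 0#)
  ∑-+ f g (x ∷ L) = trans (+-congˡ (∑-+ f g L)) (+-interchange _ _ _ _)

  ∑-*ˡ : ∀ k (f : A → K) L → ∑ (λ x → k * f x) L ≈ k * ∑ f L
  ∑-*ˡ k f [] = sym (zeroʳ k)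
  ∑-*ˡ k f (x ∷ L) = trans (+-congˡ (∑-*ˡ k f L)) (sym (distribˡ k _ _))

  ∑-*ʳ : ∀ k (f : A → K) L → ∑ (λ x → f x * k) L ≈ ∑ f L * k
  ∑-*ʳ k f [] = sym (zeroˡ k)
  ∑-*ʳ k f (x ∷ L) = trans (+-congˡ (∑-*ʳ k f L)) (sym (distribʳ k _ _))

  ∑-++ : ∀ (f : A → K) L M → ∑ f (L ++ M) ≈ ∑ f L + ∑ f M
  ∑-++ f [] M = sym (+-identityˡ _)
  ∑-++ f (x ∷ L) M = trans (+-congˡ (∑-++ f L M)) (sym (+-assoc _ _ _))

  ∑-swap : ∀ (f : A → B → K) L M
         → ∑ (λ x → ∑ (f x) M) L ≈ ∑ (λ y → ∑ (λ x → f x y) L) M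
  ∑-swap f [] M = sym (∑-zero (All.universal (λ _ → refl) M))
  ∑-swap f (x ∷ L) M = trans (+-congˡ (∑-swap f L M)) (sym (∑-+ (f x) _ M))

  ∑-concatMap : ∀ (h : B → K) (f : A → List B) L
              → ∑ h (concatMap f L) ≈ ∑ (∑ h ∘ f) L
  ∑-concatMap h f [] = refl
  ∑-concatMap h f (x ∷ L) = trans (∑-++ h (f x) (concatMap f L)) (+-congˡ (∑-concatMap h f L))

  ∑-product : ∀ (f : A → K) (g : B → K) L M → ∑ (λ x → ∑ (λ y → f x * g y) M) L ≈ ∑ f L * ∑ g M
  ∑-product f g L M = trans (∑-cong (λ x → ∑-*ˡ (f x) g M) L) (∑-*ʳ (∑ g M) f L)

  Nonzero : K → Set ℓ
  Nonzero k = ¬ k ≈ 0#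

  ¬nonzero⇒≈0 : ∀ {k} → ¬ Nonzero k → k ≈ 0#
  ¬nonzero⇒≈0 {k} ¬nz with em {P = k ≈ 0#}
  ... | yes z = z
  ... | no nz = ⊥-elim (¬nz nz)

  nonzero-*⇒nonzeroˡ : ∀ {u v} → Nonzero (u * v) → Nonzero u
  nonzero-*⇒nonzeroˡ nz z = nz (trans (*-congʳ z) (zeroˡ _))

  nonzero-*⇒nonzeroʳ : ∀ {u v} → Nonzero (u * v) → Nonzero v
  nonzero-*⇒nonzeroʳ nz z = nz (trans (*-congˡ z) (zeroʳ _))

  nonzero-∑⇒nonzero-term : ∀ (f : A → K) L → Nonzero (∑ f L) → Any (Nonzero ∘ f) L
  nonzero-∑⇒nonzero-term f [] nz = ⊥-elim (nz refl)
  nonzero-∑⇒nonzero-term f (x ∷ L) nz with em {P = f x ≈ 0#}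
  ... | no fx≉0 = here fx≉0
  ... | yes fx≈0 = there (nonzero-∑⇒nonzero-term f L (λ z → nz (trans (+-cong fx≈0 z) (+-identityˡ 0#))))

  𝟙 : ∀ {q} {Q : Set q} → Dec Q → K
  𝟙 (yes _) = 1#
  𝟙 (no _) = 0#

  𝟙-cong : ∀ {p q} {P : Set p} {Q : Set q} (dp : Dec P) (dq : Dec Q) → (P → Q) → (Q → P) → 𝟙 dp ≈ 𝟙 dq
  𝟙-cong (yes _) (yes _) _ _ = refl
  𝟙-cong (yes p) (no ¬q) p⇒q _ = ⊥-elim (¬q (p⇒q p))
  𝟙-cong (no ¬p) (yes q) _ q⇒p = ⊥-elim (¬p (q⇒p q))
  𝟙-cong (no _) (no _) _ _ = refl

  nonzero-𝟙⇒holds : ∀ {q} {Q : Set q} (d : Dec Q) → Nonzero (𝟙 d) → Q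
  nonzero-𝟙⇒holds (yes q) _ = q
  nonzero-𝟙⇒holds (no _) nz = ⊥-elim (nz refl)

  module _ {p} (P : A → Set p) (g : A → K) where

    ∑ᴾ : List A → K
    ∑ᴾ = ∑ (λ x → g x * 𝟙 (em {P = P x}))

    SumWhere-resp : ∀ {L t t'} → t ≈ t' → SumWhere S P g L t → SumWhere S P g L t'
    SumWhere-resp t≈t' (nil t≈0) = nil (trans (sym t≈t') t≈0)
    SumWhere-resp t≈t' (here Px s t≈) = here Px s (trans (sym t≈t') t≈)
    SumWhere-resp t≈t' (skip ¬Px s) = skip ¬Px (SumWhere-resp t≈t' s)

    SumWhere-∑ᴾ : ∀ L → SumWhere S P g L (∑ᴾ L)
    SumWhere-∑ᴾ [] = nil refl
    SumWhere-∑ᴾ (x ∷ L) with em {P = P x}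
    ... | yes Px = here Px (SumWhere-∑ᴾ L) (+-congʳ (*-identityʳ _))
    ... | no ¬Px = skip ¬Px (SumWhere-resp (trans (sym (+-identityˡ _)) (+-congʳ (sym (zeroʳ _)))) (SumWhere-∑ᴾ L))

    SumWhere⇒≈∑ᴾ : ∀ {L t} → SumWhere S P g L t → t ≈ ∑ᴾ L
    SumWhere⇒≈∑ᴾ (nil t≈0) = t≈0
    SumWhere⇒≈∑ᴾ {x ∷ L} (here Px s t≈) with em {P = P x}
    ... | yes _ = trans t≈ (+-cong (sym (*-identityʳ _)) (SumWhere⇒≈∑ᴾ s))
    ... | no ¬Px = ⊥-elim (¬Px Px)
    SumWhere⇒≈∑ᴾ {x ∷ L} (skip ¬Px s) with em {P = P x}
    ... | yes Px = ⊥-elim (¬Px Px)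
    ... | no _ = trans (SumWhere⇒≈∑ᴾ s) (trans (sym (+-identityˡ _)) (+-congʳ (sym (zeroʳ _))))

  module _ (w : A → K) where

    nonzero? : U.Decidable (Nonzero ∘ w)
    nonzero? x = em

    nonzeros : List A → List A
    nonzeros = filter nonzero?

    ∑-nonzeros : ∀ (g : A → K) → (∀ x → w x ≈ 0# → g x ≈ 0#) → ∀ L → ∑ g (nonzeros L) ≈ ∑ g L
    ∑-nonzeros g h [] = refl
    ∑-nonzeros g h (x ∷ L) with nonzero? x
    ... | yes _ = +-congˡ (∑-nonzeros g h L)
    ... | no ¬nz = trans (∑-nonzeros g h L) (trans (sym (+-identityˡ _)) (+-congʳ (sym (h x (¬nonzero⇒≈0 ¬nz)))))

    ∈-nonzeros : ∀ {p} {P : A → Set p} {L} → (∀ {x} → P x → Nonzero (w x)) → Any P L → Any P (nonzeros L)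
    ∈-nonzeros P⇒nz x∈L with Anyₚ.filter⁺ nonzero? x∈L
    ... | inj₁ x∈ = x∈
    ... | inj₂ ¬nz = ⊥-elim (¬nz (P⇒nz (Anyₚ.lookup-result x∈L)))

    nonzeros-All : ∀ {p} {P : A → Set p} {L} → All (λ x → Nonzero (w x) → P x) L → All P (nonzeros L)
    nonzeros-All {L = L} nz⇒P =
      All.zipWith (λ (nz , nz⇒Px) → nz⇒Px nz) (Allₚ.all-filter nonzero? L , Allₚ.filter⁺ nonzero? nz⇒P)

  module _ (pos : IsPositive S) where

    ∑≈0⇒≈0 : ∀ {f : A → K} L → ∑ f L ≈ 0# → All (λ x → f x ≈ 0#) L
    ∑≈0⇒≈0 [] _ = []
    ∑≈0⇒≈0 (x ∷ L) s≈0 = proj₁ (pos _ _ s≈0) ∷ ∑≈0⇒≈0 L (proj₂ (pos _ _ s≈0))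

  module _ (sf : IsSemifield S) where

    inverse : ∀ {w} → Nonzero w → K
    inverse {w} w≉0 = proj₁ (sf w w≉0)

    *-inverseʳ : ∀ {w} (w≉0 : Nonzero w) → w * inverse w≉0 ≈ 1#
    *-inverseʳ {w} w≉0 = proj₂ (sf w w≉0)

    *-cancel-≈0 : ∀ {w u} → Nonzero w → w * u ≈ 0# → u ≈ 0#
    *-cancel-≈0 {w} {u} w≉0 wu≈0 = begin
      u                         ≈⟨ *-identityˡ u ⟨
      1# * u                    ≈⟨ *-congʳ (trans (sym (*-inverseʳ w≉0)) (*-comm _ _)) ⟩
      (inverse w≉0 * w) * u     ≈⟨ *-assoc _ _ _ ⟩
      inverse w≉0 * (w * u)     ≈⟨ *-congˡ wu≈0 ⟩
      inverse w≉0 * 0#          ≈⟨ zeroʳ _ ⟩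
      0#                        ∎

  -- Finitely supported functions

  module OnSetoid {a e} (X : Setoid a e) where
    open Setoid X using () renaming (Carrier to |X|; _≈_ to _≈X_; refl to reflX; sym to symX; trans to transX)

    _≟_ : Decidable _≈X_
    x ≟ y = em

    decSetoid : DecSetoid a e
    decSetoid = record { isDecEquivalence = record { isEquivalence = Setoid.isEquivalence X ; _≟_ = _≟_ } }

    Distinct : List |X| → Set (a ⊔ e)
    Distinct = AllPairs (λ x y → ¬ x ≈X y)

    Covers : (|X| → K) → List |X| → Set (a ⊔ e ⊔ ℓ)
    Covers g M = ∀ x → Nonzero (g x) → Any (x ≈X_) M

    module _ {b} {B : Set b} (key : B → |X|) where

      select : (B → K) → |X| → List B → K
      select g x M = ∑ (λ y → 𝟙 (x ≟ key y) * g y) M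

      DistinctKeys : List B → Set (b ⊔ e)
      DistinctKeys = AllPairs (λ y y' → ¬ key y ≈X key y')

      select-absent : ∀ g x M → ¬ Any (λ y → x ≈X key y) M → select g x M ≈ 0#
      select-absent g x [] _ = refl
      select-absent g x (y ∷ M) x∉M with x ≟ key y
      ... | yes x≈y = ⊥-elim (x∉M (here x≈y))
      ... | no _ = trans (+-cong (zeroˡ _) (select-absent g x M (x∉M ∘ there))) (+-identityˡ 0#)

      select-∈ : ∀ g {x y} M → DistinctKeys M → y ∈ M → x ≈X key y → select g x M ≈ g y
      select-∈ g {x} (y ∷ M) (y∉M ∷ _) (here ≡.refl) x≈y with x ≟ key y
      ... | no x≉y = ⊥-elim (x≉y x≈y)
      ... | yes _ = trans (+-cong (*-identityˡ _) (select-absent g x M x∉M)) (+-identityʳ _)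
        where
        x∉M : ¬ Any (λ y' → x ≈X key y') M
        x∉M = Allₚ.All¬⇒¬Any (All.map (λ y≉y' x≈y' → y≉y' (transX (symX x≈y) x≈y')) y∉M)
      select-∈ g {x} (y₀ ∷ M) (y₀∉M ∷ dM) (there y∈M) x≈y with x ≟ key y₀
      ... | yes x≈y₀ = ⊥-elim (All.lookup y₀∉M y∈M (transX (symX x≈y₀) x≈y))
      ... | no _ = trans (+-cong (zeroˡ _) (select-∈ g M dM y∈M x≈y)) (+-identityˡ _)

    select-covering : ∀ g → Congruent _≈X_ _≈_ g → ∀ M → Distinct M → Covers g M → ∀ x → select id g x M ≈ g x
    select-covering g g-cong M dM cov x with em {P = Any (x ≈X_) M}
    ... | yes x∈M = let (y , y∈M , x≈y) = find x∈M in
                    trans (select-∈ id g M dM y∈M x≈y) (g-cong (symX x≈y))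
    ... | no x∉M = trans (select-absent id g x M x∉M) (sym (¬nonzero⇒≈0 (x∉M ∘ cov x)))

    𝟙≟-*-swap : ∀ g → Congruent _≈X_ _≈_ g → ∀ x y → 𝟙 (x ≟ y) * g y ≈ 𝟙 (y ≟ x) * g x
    𝟙≟-*-swap g g-cong x y with x ≟ y | y ≟ x
    ... | yes x≈y | yes _ = *-congˡ (g-cong (symX x≈y))
    ... | yes x≈y | no y≉x = ⊥-elim (y≉x (symX x≈y))
    ... | no x≉y | yes y≈x = ⊥-elim (x≉y (symX y≈x))
    ... | no _ | no _ = trans (zeroˡ _) (sym (zeroˡ _))

    ∑-support-indep : ∀ g → Congruent _≈X_ _≈_ g → ∀ M₁ M₂ → Distinct M₁ → Distinct M₂ → Covers g M₁ → Covers g M₂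
                    → ∑ g M₁ ≈ ∑ g M₂
    ∑-support-indep g g-cong M₁ M₂ d₁ d₂ c₁ c₂ = begin
      ∑ g M₁                                          ≈⟨ ∑-cong (λ x → sym (select-covering g g-cong M₂ d₂ c₂ x)) M₁ ⟩
      ∑ (λ x → select id g x M₂) M₁                   ≈⟨ ∑-swap (λ x y → 𝟙 (x ≟ y) * g y) M₁ M₂ ⟩
      ∑ (λ y → ∑ (λ x → 𝟙 (x ≟ y) * g y) M₁) M₂      ≈⟨ ∑-cong (λ y → ∑-cong (λ x → 𝟙≟-*-swap g g-cong x y) M₁) M₂ ⟩
      ∑ (λ y → select id g y M₁) M₂                   ≈⟨ ∑-cong (select-covering g g-cong M₁ d₁ c₁) M₂ ⟩
      ∑ g M₂                                          ∎

    linComb : List (K × FS S X) → |X| → K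
    linComb L x = ∑ (λ q → proj₁ q * fun (proj₂ q) x) L

    supports : List (K × FS S X) → List |X|
    supports = concatMap (support ∘ proj₂)

    ∈-dedup : ∀ {x} {L : List |X|} → Any (x ≈X_) L → Any (x ≈X_) (deduplicate _≟_ L)
    ∈-dedup = Anyₚ.deduplicate⁺ _≟_ (λ z≈y x≈y → transX x≈y (symX z≈y))

    ∈-supports : ∀ {x q L} → q ∈ L → Any (x ≈X_) (support (proj₂ q)) → Any (x ≈X_) (supports L)
    ∈-supports q∈L x∈q = Anyₚ.concatMap⁺ (support ∘ proj₂) (Any.map (λ { ≡.refl → x∈q }) q∈L)

    lin : List (K × FS S X) → FS S X
    lin L = record
      { fun = linComb L
      ; resp = λ x≈y → ∑-cong (λ q → *-congˡ (resp (proj₂ q) x≈y)) L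
      ; support = deduplicate _≟_ (supports L)
      ; distinct = deduplicate-! decSetoid (supports L)
      ; covers = λ x nz → ∈-dedup (Anyₚ.concatMap⁺ (support ∘ proj₂)
          (Any.map (λ {q} nz-q → covers (proj₂ q) x (nonzero-*⇒nonzeroʳ nz-q)) (nonzero-∑⇒nonzero-term _ L nz))) }

    Δ : |X| → FS S X
    Δ y = record
      { fun = λ x → 𝟙 (x ≟ y)
      ; resp = λ {x} {x'} x≈x' → 𝟙-cong (x ≟ y) (x' ≟ y) (transX (symX x≈x')) (transX x≈x')
      ; support = y ∷ []
      ; distinct = [] ∷ []
      ; covers = λ x nz → here (nonzero-𝟙⇒holds (x ≟ y) nz) }

    IsDelta⇒≈Δ : ∀ {x φ} → IsDelta S X x φ → ∀ y → fun φ y ≈ fun (Δ x) y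
    IsDelta⇒≈Δ {x} (at-x , off-x) y with y ≟ x
    ... | yes y≈x = at-x y y≈x
    ... | no y≉x = off-x y y≉x

    ≈Δ⇒IsDelta : ∀ {x φ} → (∀ y → fun φ y ≈ fun (Δ x) y) → IsDelta S X x φ
    ≈Δ⇒IsDelta {x} φ≈Δ = (λ y y≈x → trans (φ≈Δ y) (at y y≈x)) , (λ y y≉x → trans (φ≈Δ y) (off y y≉x))
      where
      at : ∀ y → y ≈X x → 𝟙 (y ≟ x) ≈ 1#
      at y y≈x with y ≟ x
      ... | yes _ = refl
      ... | no y≉x = ⊥-elim (y≉x y≈x)
      off : ∀ y → ¬ y ≈X x → 𝟙 (y ≟ x) ≈ 0#
      off y y≉x with y ≟ x
      ... | yes y≈x = ⊥-elim (y≉x y≈x)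
      ... | no _ = refl

    ⟪_,_⟫ : FS S X → (|X| → K) → K
    ⟪ φ , h ⟫ = ∑ (λ x → fun φ x * h x) (support φ)

    module _ {h : |X| → K} (h-cong : Congruent _≈X_ _≈_ h) where

      ⟪⟫-over : ∀ φ M → Distinct M → (∀ {x} → Any (x ≈X_) (support φ) → Any (x ≈X_) M)
              → ⟪ φ , h ⟫ ≈ ∑ (λ x → fun φ x * h x) M
      ⟪⟫-over φ M dM φ⊆M = ∑-support-indep (λ x → fun φ x * h x) (λ x≈y → *-cong (resp φ x≈y) (h-cong x≈y))
        (support φ) M (distinct φ) dM in-φ (λ x → φ⊆M ∘ in-φ x)
        where
        in-φ : Covers (λ x → fun φ x * h x) (support φ)
        in-φ x nz = covers φ x (nonzero-*⇒nonzeroˡ nz)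

      ⟪⟫-linear : ∀ φ L → (∀ x → fun φ x ≈ linComb L x) → ⟪ φ , h ⟫ ≈ ∑ (λ q → proj₁ q * ⟪ proj₂ q , h ⟫) L
      ⟪⟫-linear φ L φ≈L = begin
        ⟪ φ , h ⟫
          ≈⟨ ⟪⟫-over φ M dM (∈-dedup ∘ Anyₚ.++⁺ˡ) ⟩
        ∑ (λ x → fun φ x * h x) M
          ≈⟨ ∑-cong (λ x → trans (*-congʳ (φ≈L x)) (sym (∑-*ʳ (h x) _ L))) M ⟩
        ∑ (λ x → ∑ (λ q → (proj₁ q * fun (proj₂ q) x) * h x) L) M
          ≈⟨ ∑-swap _ M L ⟩
        ∑ (λ q → ∑ (λ x → (proj₁ q * fun (proj₂ q) x) * h x) M) L
          ≈⟨ ∑-cong (λ q → trans (∑-cong (λ x → *-assoc _ _ _) M) (∑-*ˡ (proj₁ q) _ M)) L ⟩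
        ∑ (λ q → proj₁ q * ∑ (λ x → fun (proj₂ q) x * h x) M) L
          ≈⟨ ∑-congᴬ {L = L} (All.tabulate (λ {q} q∈L → *-congˡ (sym (⟪⟫-over (proj₂ q) M dM
                                       (∈-dedup ∘ Anyₚ.++⁺ʳ (support φ) ∘ ∈-supports q∈L))))) ⟩
        ∑ (λ q → proj₁ q * ⟪ proj₂ q , h ⟫) L ∎
        where
        M : List |X|
        M = deduplicate _≟_ (support φ ++ supports L)
        dM : Distinct M
        dM = deduplicate-! decSetoid (support φ ++ supports L)

      ⟪⟫-cong : ∀ φ ψ → (∀ x → fun φ x ≈ fun ψ x) → ⟪ φ , h ⟫ ≈ ⟪ ψ , h ⟫
      ⟪⟫-cong φ ψ φ≈ψ = trans (⟪⟫-linear φ ((1# , ψ) ∷ []) (λ x → trans (φ≈ψ x) (sym one-term)))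
                             one-term
        where
        one-term : ∀ {k} → 1# * k + 0# ≈ k
        one-term = trans (+-identityʳ _) (*-identityˡ _)

      ⟪Δ⟫ : ∀ y → ⟪ Δ y , h ⟫ ≈ h y
      ⟪Δ⟫ y with y ≟ y
      ... | yes _ = trans (+-identityʳ _) (*-identityˡ _)
      ... | no y≉y = ⊥-elim (y≉y reflX)

      ⟪⟫-point-masses : ∀ Ψ (L : List (K × |X|)) → (∀ y → fun Ψ y ≈ ∑ (λ q → proj₁ q * 𝟙 (y ≟ proj₂ q)) L)
                      → ⟪ Ψ , h ⟫ ≈ ∑ (λ q → proj₁ q * h (proj₂ q)) L
      ⟪⟫-point-masses Ψ L Ψ≈L = begin
        ⟪ Ψ , h ⟫
          ≈⟨ ⟪⟫-linear Ψ L' (λ y → trans (Ψ≈L y) (reflexive (≡.sym (∑-map _ δ L)))) ⟩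
        ∑ (λ q → proj₁ q * ⟪ proj₂ q , h ⟫) L'       ≡⟨ ∑-map _ δ L ⟩
        ∑ (λ q → proj₁ q * ⟪ Δ (proj₂ q) , h ⟫) L    ≈⟨ ∑-cong (λ q → *-congˡ (⟪Δ⟫ (proj₂ q))) L ⟩
        ∑ (λ q → proj₁ q * h (proj₂ q)) L             ∎
        where
        δ : K × |X| → K × FS S X
        δ q = proj₁ q , Δ (proj₂ q)
        L' : List (K × FS S X)
        L' = map δ L

  -- Convex combinations

  module Convexity {a e} (X : Setoid a e) where
    open OnSetoid X public
    open Setoid X using () renaming (Carrier to |X|; _≈_ to _≈X_)
    open Setoid (𝒮 S X) using () renaming (_≈_ to _≈𝒮_)
    module 𝒮X = OnSetoid (𝒮 S X)

    _∈𝒮_ : FS S X → List (FS S X) → Set (a ⊔ c ⊔ ℓ ⊔ e)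
    χ ∈𝒮 G = Any (χ ≈𝒮_) G

    ∈𝒮-resp : ∀ G → (_∈𝒮 G) Respects _≈𝒮_
    ∈𝒮-resp G χ≈χ' = Any.map (λ χ≈ψ x → trans (sym (χ≈χ' x)) (χ≈ψ x))

    ∈⇒∈𝒮 : ∀ {χ G} → χ ∈ G → χ ∈𝒮 G
    ∈⇒∈𝒮 = Any.map (λ { ≡.refl _ → refl })

    -- Unlike the Ψ of `conv`, the terms may repeat and may carry zero weight.
    record ConvList {p} (T : FS S X → Set p) (g : |X| → K) : Set (a ⊔ e ⊔ c ⊔ ℓ ⊔ p) where
      constructor convList
      field
        terms   : List (K × FS S X)
        members : All (T ∘ proj₂) terms
        weights : ∑ proj₁ terms ≈ 1#
        value   : ∀ x → g x ≈ linComb terms x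
    open ConvList public

    -- Ψ = Σ_q w_q Δ(χ_q): the shape of χ_u ∈ c(Ω), and of the Ψ built from a convex combination.
    IsPointMassSum : FS S (𝒮 S X) → List (K × FS S X) → Set (a ⊔ e ⊔ c ⊔ ℓ)
    IsPointMassSum Ψ L = ∀ χ → fun Ψ χ ≈ ∑ (λ q → proj₁ q * 𝟙 (χ 𝒮X.≟ proj₂ q)) L

    pointMassSum : List (K × FS S X) → FS S (𝒮 S X)
    pointMassSum L = 𝒮X.lin (map (λ q → proj₁ q , 𝒮X.Δ (proj₂ q)) L)

    pointMassSum-correct : ∀ L → IsPointMassSum (pointMassSum L) L
    pointMassSum-correct L χ = reflexive (∑-map (λ q → proj₁ q * fun (proj₂ q) χ) _ L)

    module _ Ψ L (Ψ≈L : IsPointMassSum Ψ L) where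

      total-pointMassSum : total S Ψ ≈ ∑ proj₁ L
      total-pointMassSum = begin
        ∑ (fun Ψ) (support Ψ)                 ≈⟨ ∑-cong (λ χ → sym (*-identityʳ _)) (support Ψ) ⟩
        𝒮X.⟪ Ψ , (λ _ → 1#) ⟫                 ≈⟨ 𝒮X.⟪⟫-point-masses (λ _ → refl) Ψ L Ψ≈L ⟩
        ∑ (λ q → proj₁ q * 1#) L              ≈⟨ ∑-cong (λ q → *-identityʳ _) L ⟩
        ∑ proj₁ L                             ∎

      μ-pointMassSum : ∀ x → ∑ (λ χ → fun Ψ χ * fun χ x) (support Ψ) ≈ linComb L x
      μ-pointMassSum x = 𝒮X.⟪⟫-point-masses (λ χ≈χ' → χ≈χ' x) Ψ L Ψ≈L

      nonzero-pointMassSum : ∀ χ → Nonzero (fun Ψ χ) → Any (λ q → χ ≈𝒮 proj₂ q) L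
      nonzero-pointMassSum χ nz =
        Any.map (λ {q} nz-q → nonzero-𝟙⇒holds (χ 𝒮X.≟ proj₂ q) (nonzero-*⇒nonzeroʳ nz-q))
                (nonzero-∑⇒nonzero-term _ L (λ z → nz (trans (Ψ≈L χ) z)))

    module _ {z ez} {Z : Setoid z ez} (Ω : FS S Z) (u : Setoid.Carrier Z → FS S X) where

      choiceTerms : List (K × FS S X)
      choiceTerms = map (λ A → fun Ω A , u A) (support Ω)

      linComb-choiceTerms : ∀ x → linComb choiceTerms x ≡ ∑ (λ A → fun Ω A * fun (u A) x) (support Ω)
      linComb-choiceTerms x = ∑-map (λ q → proj₁ q * fun (proj₂ q) x) _ (support Ω)

      ∑ᴾ-choice : ∀ χ → ∑ᴾ (λ A → u A ≈𝒮 χ) (fun Ω) (support Ω) ≈ ∑ (λ q → proj₁ q * 𝟙 (χ 𝒮X.≟ proj₂ q)) choiceTerms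
      ∑ᴾ-choice χ = trans
        (∑-cong (λ A → *-congˡ (𝟙-cong em (χ 𝒮X.≟ u A) (λ u≈χ x → sym (u≈χ x)) (λ χ≈u x → sym (χ≈u x)))) (support Ω))
        (reflexive (≡.sym (∑-map (λ q → proj₁ q * 𝟙 (χ 𝒮X.≟ proj₂ q)) _ (support Ω))))

      SumWhere⇒IsPointMassSum : ∀ {Ψ} → (∀ χ → SumWhere S (λ A → u A ≈𝒮 χ) (fun Ω) (support Ω) (fun Ψ χ))
                              → IsPointMassSum Ψ choiceTerms
      SumWhere⇒IsPointMassSum Ψ=χᵤ χ = trans (SumWhere⇒≈∑ᴾ (λ A → u A ≈𝒮 χ) (fun Ω) (Ψ=χᵤ χ)) (∑ᴾ-choice χ)

      IsPointMassSum⇒SumWhere : ∀ {Ψ} → IsPointMassSum Ψ choiceTerms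
                              → ∀ χ → SumWhere S (λ A → u A ≈𝒮 χ) (fun Ω) (support Ω) (fun Ψ χ)
      IsPointMassSum⇒SumWhere Ψ≈ χ = SumWhere-resp (λ A → u A ≈𝒮 χ) (fun Ω) (sym (trans (Ψ≈ χ) (sym (∑ᴾ-choice χ))))
                                                   (SumWhere-∑ᴾ (λ A → u A ≈𝒮 χ) (fun Ω) (support Ω))

    conv⇒ConvList : ∀ {p} (T : FS S X → Set p) φ → conv S X T φ → ConvList T (fun φ)
    conv⇒ConvList T φ (Ψ , Ψ⊆T , total≈1 , φ≈μΨ) = record
      { terms   = map (λ χ → fun Ψ χ , χ) (nonzeros (fun Ψ) (support Ψ))
      ; members = Allₚ.map⁺ (All.map (Ψ⊆T _) (Allₚ.all-filter (nonzero? (fun Ψ)) (support Ψ)))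
      ; weights = begin
          ∑ proj₁ (map (λ χ → fun Ψ χ , χ) supp⁺)  ≡⟨ ∑-map proj₁ _ supp⁺ ⟩
          ∑ (fun Ψ) supp⁺                          ≈⟨ ∑-nonzeros (fun Ψ) (fun Ψ) (λ _ z → z) (support Ψ) ⟩
          total S Ψ                                ≈⟨ total≈1 ⟩
          1#                                       ∎
      ; value = λ x → begin
          fun φ x                                     ≈⟨ φ≈μΨ x ⟩
          ∑ (λ χ → fun Ψ χ * fun χ x) (support Ψ)     ≈⟨ ∑-nonzeros (fun Ψ) _ (λ _ z → trans (*-congʳ z) (zeroˡ _)) (support Ψ) ⟨
          ∑ (λ χ → fun Ψ χ * fun χ x) supp⁺           ≡⟨ ∑-map (λ q → proj₁ q * fun (proj₂ q) x) _ supp⁺ ⟨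
          linComb (map (λ χ → fun Ψ χ , χ) supp⁺) x   ∎ }
      where
      supp⁺ : List (FS S X)
      supp⁺ = nonzeros (fun Ψ) (support Ψ)

    ConvList⇒conv : ∀ {p} (T : FS S X → Set p) → T Respects _≈𝒮_ → ∀ φ → ConvList T (fun φ) → conv S X T φ
    ConvList⇒conv T T-resp φ (convList L L⊆T w≈1 φ≈L) =
      Ψ , Ψ⊆T , trans (total-pointMassSum Ψ L Ψ≈L) w≈1 , λ x → trans (φ≈L x) (sym (μ-pointMassSum Ψ L Ψ≈L x))
      where
      Ψ : FS S (𝒮 S X)
      Ψ = pointMassSum L
      Ψ≈L : IsPointMassSum Ψ L
      Ψ≈L = pointMassSum-correct L
      Ψ⊆T : ∀ χ → Nonzero (fun Ψ χ) → T χ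
      Ψ⊆T χ nz = let (q , q∈L , χ≈q) = find (nonzero-pointMassSum Ψ L Ψ≈L χ nz) in
                 T-resp (λ x → sym (χ≈q x)) (All.lookup L⊆T q∈L)

    conv-resp : ∀ {p} (T : FS S X → Set p) → conv S X T Respects _≈𝒮_
    conv-resp T χ≈χ' (Ψ , Ψ⊆T , total≈1 , χ≈μΨ) = Ψ , Ψ⊆T , total≈1 , λ x → trans (sym (χ≈χ' x)) (χ≈μΨ x)

    pred-resp : ∀ (A : CSet S X) → pred A Respects _≈𝒮_
    pred-resp A {χ} {χ'} χ≈χ' χ∈A =
      Equivalence.from (closed A χ') (conv-resp (pred A) {χ} {χ'} χ≈χ' (Equivalence.to (closed A χ) χ∈A))

    ConvList⇒pred : ∀ (A : CSet S X) {φ} → ConvList (pred A) (fun φ) → pred A φ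
    ConvList⇒pred A {φ} C = Equivalence.from (closed A φ) (ConvList⇒conv (pred A) (λ {χ} {χ'} → pred-resp A {χ} {χ'}) φ C)

    ConvList-resp : ∀ {p} {T : FS S X → Set p} {g g'} → (∀ x → g x ≈ g' x) → ConvList T g → ConvList T g'
    ConvList-resp g≈g' (convList L L⊆T w≈1 g≈L) = convList L L⊆T w≈1 (λ x → trans (sym (g≈g' x)) (g≈L x))

    ConvList-mono : ∀ {p q} {T : FS S X → Set p} {T' : FS S X → Set q} {g}
                  → (∀ {χ} → T χ → T' χ) → ConvList T g → ConvList T' g
    ConvList-mono T⊆T' (convList L L⊆T w≈1 g≈L) = convList L (All.map T⊆T' L⊆T) w≈1 g≈L

    ConvList-single : ∀ {p} {T : FS S X → Set p} χ → T χ → ConvList T (fun χ)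
    ConvList-single χ Tχ =
      convList ((1# , χ) ∷ []) (Tχ ∷ []) (+-identityʳ _) (λ x → sym (trans (+-identityʳ _) (*-identityˡ _)))

    private
      scale : K → List (K × FS S X) → List (K × FS S X)
      scale w = map (λ q → w * proj₁ q , proj₂ q)

      ∑-weights-scale : ∀ w L → ∑ proj₁ (scale w L) ≈ w * ∑ proj₁ L
      ∑-weights-scale w L = trans (reflexive (∑-map proj₁ _ L)) (∑-*ˡ w proj₁ L)

      linComb-scale : ∀ w L x → linComb (scale w L) x ≈ w * linComb L x
      linComb-scale w L x = begin
        linComb (scale w L) x                          ≡⟨ ∑-map (λ q → proj₁ q * fun (proj₂ q) x) _ L ⟩
        ∑ (λ q → (w * proj₁ q) * fun (proj₂ q) x) L    ≈⟨ ∑-cong (λ q → *-assoc _ _ _) L ⟩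
        ∑ (λ q → w * (proj₁ q * fun (proj₂ q) x)) L    ≈⟨ ∑-*ˡ w _ L ⟩
        w * linComb L x                                ∎

    module _ {p} {T : FS S X → Set p} where

      Expansions : List (K × FS S X) → Set (a ⊔ e ⊔ c ⊔ ℓ ⊔ p)
      Expansions = All (λ q → ConvList T (fun (proj₂ q)))

      flattenTerms : ∀ {L} → Expansions L → List (K × FS S X)
      flattenTerms [] = []
      flattenTerms {(w , _) ∷ _} (C ∷ Cs) = scale w (terms C) ++ flattenTerms Cs

      flattenTerms-members : ∀ {L} (Cs : Expansions L) → All (T ∘ proj₂) (flattenTerms Cs)
      flattenTerms-members [] = []
      flattenTerms-members (C ∷ Cs) = Allₚ.++⁺ (Allₚ.map⁺ (members C)) (flattenTerms-members Cs)

      flattenTerms-weights : ∀ {L} (Cs : Expansions L) → ∑ proj₁ (flattenTerms Cs) ≈ ∑ proj₁ L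
      flattenTerms-weights [] = refl
      flattenTerms-weights {(w , _) ∷ _} (C ∷ Cs) =
        trans (∑-++ proj₁ (scale w (terms C)) _)
              (+-cong (trans (∑-weights-scale w (terms C)) (trans (*-congˡ (weights C)) (*-identityʳ w)))
                      (flattenTerms-weights Cs))

      flattenTerms-value : ∀ {L} (Cs : Expansions L) → ∀ x → linComb (flattenTerms Cs) x ≈ linComb L x
      flattenTerms-value [] x = refl
      flattenTerms-value {(w , _) ∷ _} (C ∷ Cs) x =
        trans (∑-++ (λ q → proj₁ q * fun (proj₂ q) x) (scale w (terms C)) _)
              (+-cong (trans (linComb-scale w (terms C) x) (*-congˡ (sym (value C x))))
                      (flattenTerms-value Cs x))

      ConvList-flatten : ∀ {q} {T' : FS S X → Set q} {g} → ConvList T' g → (∀ {χ} → T' χ → ConvList T (fun χ)) → ConvList T g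
      ConvList-flatten (convList L L⊆T' w≈1 g≈L) expand = record
        { terms = flattenTerms Cs
        ; members = flattenTerms-members Cs
        ; weights = trans (flattenTerms-weights Cs) w≈1
        ; value = λ x → trans (g≈L x) (sym (flattenTerms-value Cs x)) }
        where
        Cs : Expansions L
        Cs = All.map expand L⊆T'

    ConvList-affine : ∀ {p₁ p₂ p} {T₁ : FS S X → Set p₁} {T₂ : FS S X → Set p₂} {T : FS S X → Set p} β {g₁ g₂}
                    → (∀ {χ₁ χ₂} → T₁ χ₁ → T₂ χ₂ → T (lin ((β , χ₁) ∷ (1# , χ₂) ∷ [])))
                    → ConvList T₁ g₁ → ConvList T₂ g₂ → ConvList T (λ x → β * g₁ x + g₂ x)
    ConvList-affine {T = T} β {g₁} {g₂} combine (convList L₁ L₁⊆T₁ w₁≈1 g₁≈L₁) (convList L₂ L₂⊆T₂ w₂≈1 g₂≈L₂) =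
      convList L (Allₚ.concat⁺ (Allₚ.map⁺ (All.map (λ t₁ → Allₚ.map⁺ (All.map (combine t₁) L₂⊆T₂)) L₁⊆T₁))) weights′ value′
      where
      pair : K × FS S X → K × FS S X → K × FS S X
      pair q₁ q₂ = proj₁ q₁ * proj₁ q₂ , lin ((β , proj₂ q₁) ∷ (1# , proj₂ q₂) ∷ [])
      L : List (K × FS S X)
      L = concatMap (λ q₁ → map (pair q₁) L₂) L₁

      ∑-pairs : ∀ h → ∑ h L ≈ ∑ (λ q₁ → ∑ (λ q₂ → h (pair q₁ q₂)) L₂) L₁
      ∑-pairs h = trans (∑-concatMap h _ L₁) (∑-cong (λ q₁ → reflexive (∑-map h (pair q₁) L₂)) L₁)

      weights′ : ∑ proj₁ L ≈ 1#
      weights′ = begin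
        ∑ proj₁ L                   ≈⟨ ∑-pairs proj₁ ⟩
        _                           ≈⟨ ∑-product proj₁ proj₁ L₁ L₂ ⟩
        ∑ proj₁ L₁ * ∑ proj₁ L₂     ≈⟨ *-cong w₁≈1 w₂≈1 ⟩
        1# * 1#                     ≈⟨ *-identityˡ 1# ⟩
        1#                          ∎

      expand : ∀ b w₁ w₂ a₁ a₂ → (w₁ * w₂) * (b * a₁ + (1# * a₂ + 0#)) ≈ (w₁ * (b * a₁)) * w₂ + w₁ * (w₂ * a₂)
      expand = solve 5 (λ b w₁ w₂ a₁ a₂ → (w₁ :* w₂) :* (b :* a₁ :+ (con 1 :* a₂ :+ con 0))
                                        := (w₁ :* (b :* a₁)) :* w₂ :+ w₁ :* (w₂ :* a₂)) refl

      value′ : ∀ x → β * g₁ x + g₂ x ≈ linComb L x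
      value′ x = sym (begin
        linComb L x
          ≈⟨ ∑-pairs (λ q → proj₁ q * fun (proj₂ q) x) ⟩
        ∑ (λ q₁ → ∑ (λ q₂ → (wt q₁ * wt q₂) * (β * at q₁ + (1# * at q₂ + 0#))) L₂) L₁
          ≈⟨ ∑-cong (λ q₁ → trans (∑-cong (λ q₂ → expand β (wt q₁) (wt q₂) (at q₁) (at q₂)) L₂) (∑-+ _ _ L₂)) L₁ ⟩
        ∑ (λ q₁ → ∑ (λ q₂ → (wt q₁ * (β * at q₁)) * wt q₂) L₂ + ∑ (λ q₂ → wt q₁ * (wt q₂ * at q₂)) L₂) L₁
          ≈⟨ ∑-+ _ _ L₁ ⟩
        _ ≈⟨ +-cong (∑-product (λ q₁ → wt q₁ * (β * at q₁)) proj₁ L₁ L₂) (∑-product proj₁ (λ q₂ → wt q₂ * at q₂) L₁ L₂) ⟩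
        ∑ (λ q₁ → wt q₁ * (β * at q₁)) L₁ * ∑ proj₁ L₂ + ∑ proj₁ L₁ * linComb L₂ x
          ≈⟨ +-cong (trans (*-congˡ w₂≈1) (*-identityʳ _)) (trans (*-congʳ w₁≈1) (*-identityˡ _)) ⟩
        ∑ (λ q₁ → wt q₁ * (β * at q₁)) L₁ + linComb L₂ x
          ≈⟨ +-congʳ (trans (∑-cong (λ q₁ → x∙yz≈y∙xz (wt q₁) β (at q₁)) L₁) (∑-*ˡ β _ L₁)) ⟩
        β * linComb L₁ x + linComb L₂ x
          ≈⟨ +-cong (*-congˡ (g₁≈L₁ x)) (g₂≈L₂ x) ⟨
        β * g₁ x + g₂ x ∎)
        where
        wt : K × FS S X → K
        wt = proj₁
        at : K × FS S X → K
        at q = fun (proj₂ q) x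

    ConvList-representatives : ∀ {b} {B : Set b} (h : B → FS S X) {G : List B} {g}
      → ConvList (λ χ → Any (λ t → χ ≈𝒮 h t) G) g
      → Σ[ L ∈ List (K × B) ] (All ((_∈ G) ∘ proj₂) L × ∑ proj₁ L ≈ 1#
                               × (∀ x → g x ≈ linComb (map (λ q → proj₁ q , h (proj₂ q)) L) x))
    ConvList-representatives h {G} (convList L L∈ w≈1 g≈L) with representatives L L∈
      where
      representatives : ∀ L → All (λ q → Any (λ t → proj₂ q ≈𝒮 h t) G) L
        → Σ[ L' ∈ List (K × _) ] (All ((_∈ G) ∘ proj₂) L' × ∑ proj₁ L' ≡ ∑ proj₁ L
                                  × (∀ x → linComb L x ≈ linComb (map (λ q → proj₁ q , h (proj₂ q)) L') x))
      representatives [] [] = [] , [] , ≡.refl , λ _ → refl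
      representatives ((w , χ) ∷ L) (χ∈ ∷ L∈) with find χ∈ | representatives L L∈
      ... | t , t∈G , χ≈t | L' , L'∈G , w≡ , L≈L' =
        (w , t) ∷ L' , t∈G ∷ L'∈G , ≡.cong (w +_) w≡ , λ x → +-cong (*-congˡ (χ≈t x)) (L≈L' x)
    ... | L' , L'∈G , w≡ , L≈L' = L' , L'∈G , trans (reflexive w≡) w≈1 , λ x → trans (g≈L x) (L≈L' x)

    ConvList-nonzero : ∀ {p} {T : FS S X → Set p} L → All (λ q → Nonzero (proj₁ q) → T (proj₂ q)) L → ∑ proj₁ L ≈ 1#
                     → ConvList T (linComb L)
    ConvList-nonzero L nz⇒T w≈1 = convList (nonzeros proj₁ L) (nonzeros-All proj₁ nz⇒T)
      (trans (∑-nonzeros proj₁ proj₁ (λ _ z → z) L) w≈1)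
      (λ x → sym (∑-nonzeros proj₁ _ (λ _ z → trans (*-congʳ z) (zeroˡ _)) L))

    module _ (pos : IsPositive S) where

      combination-zero : ∀ {φ : FS S X} L → (∀ x → fun φ x ≈ linComb L x) → ∀ {q x} → q ∈ L → fun φ x ≈ 0#
                       → proj₁ q * fun (proj₂ q) x ≈ 0#
      combination-zero L φ≈L {x = x} q∈L φx≈0 = All.lookup (∑≈0⇒≈0 pos L (trans (sym (φ≈L x)) φx≈0)) q∈L

      module _ (sf : IsSemifield S) where

        combination-support : ∀ {φ : FS S X} L → (∀ x → fun φ x ≈ linComb L x) → ∀ {q x} → q ∈ L → Nonzero (proj₁ q)
                            → Nonzero (fun (proj₂ q) x) → Nonzero (fun φ x)
        combination-support {φ} L φ≈L {x = x} q∈L w≉0 qx≉0 φx≈0 =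
          qx≉0 (*-cancel-≈0 sf w≉0 (combination-zero {φ} L φ≈L {x = x} q∈L φx≈0))

        -- lin [] is a junk value for weights summing to 0; it only ever appears multiplied by that sum.
        barycenterᵈ : ∀ L → Dec (∑ proj₁ L ≈ 0#) → FS S X
        barycenterᵈ L (yes _) = lin []
        barycenterᵈ L (no s≉0) = lin (scale (inverse sf s≉0) L)

        barycenter : List (K × FS S X) → FS S X
        barycenter L = barycenterᵈ L em

        barycenter-value : ∀ L x → ∑ proj₁ L * fun (barycenter L) x ≈ linComb L x
        barycenter-value L x = value-for em
          where
          value-for : ∀ d → ∑ proj₁ L * fun (barycenterᵈ L d) x ≈ linComb L x
          value-for (yes s≈0) =
            trans (zeroʳ _) (sym (∑-zero (All.map (λ w≈0 → trans (*-congʳ w≈0) (zeroˡ _)) (∑≈0⇒≈0 pos L s≈0))))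
          value-for (no s≉0) = begin
            ∑ proj₁ L * linComb (scale (inverse sf s≉0) L) x    ≈⟨ *-congˡ (linComb-scale _ L x) ⟩
            ∑ proj₁ L * (inverse sf s≉0 * linComb L x)          ≈⟨ *-assoc _ _ _ ⟨
            (∑ proj₁ L * inverse sf s≉0) * linComb L x          ≈⟨ *-congʳ (*-inverseʳ sf s≉0) ⟩
            1# * linComb L x                                    ≈⟨ *-identityˡ _ ⟩
            linComb L x                                         ∎

        barycenter-∈ : ∀ (A : CSet S X) L → Nonzero (∑ proj₁ L) → All (λ q → Nonzero (proj₁ q) → pred A (proj₂ q)) L
                     → pred A (barycenter L)
        barycenter-∈ A L s≉0 nz⇒A = ∈-for em
          where
          ∈-for : ∀ d → pred A (barycenterᵈ L d)
          ∈-for (yes s≈0) = ⊥-elim (s≉0 s≈0)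
          ∈-for (no s≉0) = ConvList⇒pred A {lin (scale i L)}
            (ConvList-nonzero (scale i L) (Allₚ.map⁺ (All.map (λ nz⇒χ∈A iw≉0 → nz⇒χ∈A (nonzero-*⇒nonzeroʳ iw≉0)) nz⇒A))
              (trans (∑-weights-scale i L) (trans (*-comm _ _) (*-inverseʳ sf s≉0))))
            where
            i : K
            i = inverse sf s≉0

    convCSet : ∀ (T : FS S X → Set (a ⊔ e ⊔ c ⊔ ℓ)) → T Respects _≈𝒮_ → CSet S X
    convCSet T T-resp = record
      { pred = conv S X T
      ; closed = λ φ → mk⇔
          (λ φ∈ → ConvList⇒conv (conv S X T) (λ {χ} {χ'} → conv-resp T {χ} {χ'}) φ (ConvList-single {T = conv S X T} φ φ∈))
          (λ φ∈ → ConvList⇒conv T T-resp φ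
                   (ConvList-flatten (conv⇒ConvList (conv S X T) φ φ∈) (λ {χ} → conv⇒ConvList T χ))) }

    hull : List (FS S X) → Setoid.Carrier (𝒞f S X)
    hull G = convCSet (_∈𝒮 G) (λ {χ} {χ'} → ∈𝒮-resp G {χ} {χ'}) , G , λ φ → mk⇔ id id

    gens : Setoid.Carrier (𝒞f S X) → List (FS S X)
    gens A = proj₁ (proj₂ A)

    fg⇒ConvList : ∀ (A : Setoid.Carrier (𝒞f S X)) {φ} → pred (proj₁ A) φ → ConvList (_∈𝒮 gens A) (fun φ)
    fg⇒ConvList (_ , G , A≈convG) {φ} φ∈A = conv⇒ConvList (_∈𝒮 G) φ (Equivalence.to (A≈convG φ) φ∈A)

    ConvList⇒fg : ∀ (A : Setoid.Carrier (𝒞f S X)) {φ} → ConvList (_∈𝒮 gens A) (fun φ) → pred (proj₁ A) φ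
    ConvList⇒fg (_ , G , A≈convG) {φ} C =
      Equivalence.from (A≈convG φ) (ConvList⇒conv (_∈𝒮 G) (λ {χ} {χ'} → ∈𝒮-resp G {χ} {χ'}) φ C)

    linComb-constant : ∀ (h : |X| → K) L → All (λ q → ∀ y → fun (proj₂ q) y ≈ h y) L → ∀ y → linComb L y ≈ ∑ proj₁ L * h y
    linComb-constant h [] [] y = sym (zeroˡ _)
    linComb-constant h (q ∷ L) (q≈h ∷ L≈h) y =
      trans (+-cong (*-congˡ (q≈h y)) (linComb-constant h L L≈h y)) (sym (distribʳ _ _ _))

    Δ-hull : ∀ x φ → IsDelta S X x φ ⇔ pred (proj₁ (hull (Δ x ∷ []))) φ
    Δ-hull x φ = mk⇔
      (λ φ≈Δ → ConvList⇒conv (_∈𝒮 (Δ x ∷ [])) (λ {χ} {χ'} → ∈𝒮-resp (Δ x ∷ []) {χ} {χ'}) φ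
                 (ConvList-resp (λ y → sym (IsDelta⇒≈Δ {x} {φ} φ≈Δ y))
                                (ConvList-single {T = _∈𝒮 (Δ x ∷ [])} (Δ x) (here (λ _ → refl)))))
      (λ φ∈ → ≈Δ⇒IsDelta {x} {φ} (λ y → only-Δ (conv⇒ConvList (_∈𝒮 (Δ x ∷ [])) φ φ∈) y))
      where
      only-Δ : ∀ {g} → ConvList (_∈𝒮 (Δ x ∷ [])) g → ∀ y → g y ≈ fun (Δ x) y
      only-Δ (convList L L∈Δ w≈1 g≈L) y = begin
        _                         ≈⟨ g≈L y ⟩
        linComb L y               ≈⟨ linComb-constant (fun (Δ x)) L (All.map (λ { (here χ≈Δ) → χ≈Δ ; (there ()) }) L∈Δ) y ⟩
        ∑ proj₁ L * fun (Δ x) y   ≈⟨ *-congʳ w≈1 ⟩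
        1# * fun (Δ x) y          ≈⟨ *-identityˡ _ ⟩
        fun (Δ x) y               ∎

  -- The action on maps

  module Pushforward {a e} {X Y : Setoid a e} (f : Func X Y) where
    private
      module CX = Convexity X
      module CY = Convexity Y
    open Setoid X using () renaming (_≈_ to _≈X_)
    open Setoid Y using () renaming (_≈_ to _≈Y_; sym to symY; trans to transY)
    open Func f using (to; cong)

    fiber : Setoid.Carrier Y → Setoid.Carrier X → K
    fiber y x = 𝟙 (to x CY.≟ y)

    fiber-cong : ∀ y → Congruent _≈X_ _≈_ (fiber y)
    fiber-cong y {x} {x'} x≈x' =
      𝟙-cong (to x CY.≟ y) (to x' CY.≟ y) (transY (symY (cong x≈x'))) (transY (cong x≈x'))

    push : FS S X → FS S Y
    push φ = record
      { fun = λ y → CX.⟪ φ , fiber y ⟫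
      ; resp = λ {y} {y'} y≈y' → ∑-cong (λ x → *-congˡ (𝟙-cong (to x CY.≟ y) (to x CY.≟ y')
                                                       (λ fx≈y → transY fx≈y y≈y') (λ fx≈y' → transY fx≈y' (symY y≈y'))))
                                        (support φ)
      ; support = deduplicate CY._≟_ (map to (support φ))
      ; distinct = deduplicate-! CY.decSetoid (map to (support φ))
      ; covers = λ y nz → CY.∈-dedup (Anyₚ.map⁺
          (Any.map (λ {x} nz-x → symY (nonzero-𝟙⇒holds (to x CY.≟ y) (nonzero-*⇒nonzeroʳ nz-x)))
                   (nonzero-∑⇒nonzero-term _ (support φ) nz))) }

    push-IsPush : ∀ φ → IsPush S f φ (push φ)
    push-IsPush φ y = SumWhere-∑ᴾ (λ x → to x ≈Y y) (fun φ) (support φ)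

    IsPush⇒≈push : ∀ {φ ψ} → IsPush S f φ ψ → ∀ y → fun ψ y ≈ fun (push φ) y
    IsPush⇒≈push {φ} {ψ} ψ=fφ y = SumWhere⇒≈∑ᴾ (λ x → to x ≈Y y) (fun φ) (ψ=fφ y)

    push-cong : ∀ φ φ' → (∀ x → fun φ x ≈ fun φ' x) → ∀ y → fun (push φ) y ≈ fun (push φ') y
    push-cong φ φ' φ≈φ' y = CX.⟪⟫-cong (fiber-cong y) φ φ' φ≈φ'

    pushTerms : List (K × FS S X) → List (K × FS S Y)
    pushTerms = map (λ q → proj₁ q , push (proj₂ q))

    push-linear : ∀ φ L → (∀ x → fun φ x ≈ CX.linComb L x) → ∀ y → fun (push φ) y ≈ CY.linComb (pushTerms L) y
    push-linear φ L φ≈L y = trans (CX.⟪⟫-linear (fiber-cong y) φ L φ≈L) (reflexive (≡.sym (∑-map _ _ L)))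

    ConvList-push : ∀ {G φ} → CX.ConvList (CX._∈𝒮 G) (fun φ) → CY.ConvList (CY._∈𝒮 map push G) (fun (push φ))
    ConvList-push {G} {φ} (CX.convList L L∈G w≈1 φ≈L) = CY.convList (pushTerms L)
      (Allₚ.map⁺ (All.map (λ {q} χ∈G → Anyₚ.map⁺ (Any.map (λ {g} → push-cong (proj₂ q) g) χ∈G)) L∈G))
      (trans (reflexive (∑-map proj₁ _ L)) w≈1)
      (push-linear φ L φ≈L)

    push-hull : ∀ (A : Setoid.Carrier (𝒞f S X)) ψ
              → CImage S f (proj₁ A) ψ ⇔ pred (proj₁ (CY.hull (map push (CX.gens A)))) ψ
    push-hull A ψ = mk⇔ image⇒hull hull⇒image
      where
      G : List (FS S X)
      G = CX.gens A
      image⇒hull : CImage S f (proj₁ A) ψ → pred (proj₁ (CY.hull (map push G))) ψ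
      image⇒hull (φ , φ∈A , ψ=fφ) = CY.ConvList⇒conv (CY._∈𝒮 map push G) (λ {χ} {χ'} → CY.∈𝒮-resp (map push G) {χ} {χ'}) ψ
        (CY.ConvList-resp {T = CY._∈𝒮 map push G} (λ y → sym (IsPush⇒≈push {φ} {ψ} ψ=fφ y))
                          (ConvList-push {φ = φ} (CX.fg⇒ConvList A φ∈A)))
      hull⇒image : pred (proj₁ (CY.hull (map push G))) ψ → CImage S f (proj₁ A) ψ
      hull⇒image ψ∈ with CY.ConvList-representatives push
                           (CY.ConvList-mono Anyₚ.map⁻ (CY.conv⇒ConvList (CY._∈𝒮 map push G) ψ ψ∈))
      ... | L , L∈G , w≈1 , ψ≈L =
        CX.lin L , CX.ConvList⇒fg A (CX.convList L (All.map CX.∈⇒∈𝒮 L∈G) w≈1 (λ _ → refl)) ,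
        λ y → SumWhere-resp (λ x → to x ≈Y y) (fun (CX.lin L))
                            (sym (trans (ψ≈L y) (sym (push-linear (CX.lin L) L (λ _ → refl) y))))
                            (push-IsPush (CX.lin L) y)

  -- The multiplication

  module Multiplication {a e} (X : Setoid a e) (pos : IsPositive S) (sf : IsSemifield S) where
    Z : Setoid (Level.suc (a ⊔ e ⊔ c ⊔ ℓ)) (a ⊔ e ⊔ c ⊔ ℓ)
    Z = 𝒞f S X
    private
      module CX = Convexity X
      module CZ = Convexity Z
      module Z = Setoid Z
    open Setoid Z using () renaming (Carrier to Zc; _≈_ to _≈Z_)

    ≈Z⇒pred : ∀ {A B} → A ≈Z B → ∀ {φ} → pred (proj₁ A) φ → pred (proj₁ B) φ
    ≈Z⇒pred A≈B {φ} = proj₁ (A≈B φ)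

    gens⊆pred : ∀ A {g} → g ∈ CX.gens A → pred (proj₁ A) g
    gens⊆pred A {g} g∈ = CX.ConvList⇒fg A (CX.ConvList-single {T = CX._∈𝒮 CX.gens A} g (CX.∈⇒∈𝒮 g∈))

    -- A choice u in c(Ω) need not respect ≈ on 𝒞_f X; for distinct keys, `fromTable` respects ≈
    -- and agrees with the table.
    module _ {b} {B : Set b} (key : B → Zc) (val : B → FS S X) where

      fromTable : List B → Zc → FS S X
      fromTable M A = CX.lin (map (λ t → 𝟙 (A CZ.≟ key t) , val t) M)

      fromTable-select : ∀ M A x → fun (fromTable M A) x ≡ CZ.select key (λ t → fun (val t) x) A M
      fromTable-select M A x = ∑-map (λ q → proj₁ q * fun (proj₂ q) x) _ M

      fromTable-cong : ∀ M x → Congruent _≈Z_ _≈_ (λ A → fun (fromTable M A) x)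
      fromTable-cong M x {A} {A'} A≈A' = begin
        fun (fromTable M A) x                     ≡⟨ fromTable-select M A x ⟩
        CZ.select key (λ t → fun (val t) x) A M   ≈⟨ ∑-cong (λ t → *-congʳ (𝟙-cong (A CZ.≟ key t) (A' CZ.≟ key t)
                                                        (Z.trans {A'} {A} {key t} (Z.sym {A} {A'} A≈A'))
                                                        (Z.trans {A} {A'} {key t} A≈A'))) M ⟩
        CZ.select key (λ t → fun (val t) x) A' M  ≡⟨ fromTable-select M A' x ⟨
        fun (fromTable M A') x                    ∎

      fromTable-∈ : ∀ M {A t} → CZ.DistinctKeys key M → t ∈ M → A ≈Z key t → ∀ x → fun (fromTable M A) x ≈ fun (val t) x
      fromTable-∈ M {A} {t} dM t∈M A≈t x =
        trans (reflexive (fromTable-select M A x)) (CZ.select-∈ key (λ t → fun (val t) x) {A} {t} M dM t∈M A≈t)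

      fromTable-pred : ∀ M {A t} → CZ.DistinctKeys key M → t ∈ M → A ≈Z key t → pred (proj₁ (key t)) (val t)
                     → pred (proj₁ A) (fromTable M A)
      fromTable-pred M {A} {t} dM t∈M A≈t t∈ =
        CX.pred-resp (proj₁ A) {val t} {fromTable M A} (λ x → sym (fromTable-∈ M {A} {t} dM t∈M A≈t x))
                     (≈Z⇒pred {key t} {A} (Z.sym {A} {key t} A≈t) t∈)

    data Choice : List Zc → List (Zc × FS S X) → Set (Level.suc (a ⊔ e ⊔ c ⊔ ℓ)) where
      []  : Choice [] []
      _∷_ : ∀ {A F g P} → g ∈ CX.gens A → Choice F P → Choice (A ∷ F) ((A , g) ∷ P)

    choices : List Zc → List (List (Zc × FS S X))
    choices [] = [] ∷ []
    choices (A ∷ F) = concatMap (λ g → map ((A , g) ∷_) (choices F)) (CX.gens A)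

    Choice⇒∈choices : ∀ {F P} → Choice F P → P ∈ choices F
    Choice⇒∈choices [] = here ≡.refl
    Choice⇒∈choices {A ∷ F} (g∈ ∷ ch) =
      Anyₚ.concatMap⁺ _ (Any.map (λ { ≡.refl → Anyₚ.map⁺ (Any.map (≡.cong _) (Choice⇒∈choices ch)) }) g∈)

    ∈choices⇒Choice : ∀ F {P} → P ∈ choices F → Choice F P
    ∈choices⇒Choice [] (here ≡.refl) = []
    ∈choices⇒Choice (A ∷ F) P∈ with find (Anyₚ.concatMap⁻ (λ g → map ((A , g) ∷_) (choices F)) {xs = CX.gens A} P∈)
    ... | g , g∈ , P∈′ with find (Anyₚ.map⁻ P∈′)
    ... | P′ , P′∈ , ≡.refl = g∈ ∷ ∈choices⇒Choice F P′∈

    Choice-keys : ∀ {F P} → Choice F P → map proj₁ P ≡ F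
    Choice-keys [] = ≡.refl
    Choice-keys (_ ∷ ch) = ≡.cong (_ ∷_) (Choice-keys ch)

    Choice-gens : ∀ {F P} → Choice F P → All (λ t → proj₂ t ∈ CX.gens (proj₁ t)) P
    Choice-gens [] = []
    Choice-gens (g∈ ∷ ch) = g∈ ∷ Choice-gens ch

    support⁺ : FS S Z → List Zc
    support⁺ Ω = nonzeros (fun Ω) (support Ω)

    choiceSum : FS S Z → List (Zc × FS S X) → FS S X
    choiceSum Ω P = CX.lin (map (λ t → fun Ω (proj₁ t) , proj₂ t) P)

    IsChoiceSum : FS S Z → List Zc → FS S X → Set (Level.suc (a ⊔ e ⊔ c ⊔ ℓ))
    IsChoiceSum Ω F χ = Σ[ P ∈ List (Zc × FS S X) ] (Choice F P × (∀ x → fun χ x ≈ fun (choiceSum Ω P) x))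

    ConvList-choiceSum : ∀ Ω (v : Zc → FS S X) F → All (λ A → CX.ConvList (CX._∈𝒮 CX.gens A) (fun (v A))) F
                       → CX.ConvList (IsChoiceSum Ω F) (λ x → ∑ (λ A → fun Ω A * fun (v A) x) F)
    ConvList-choiceSum Ω v [] [] = CX.ConvList-single (CX.lin []) ([] , [] , λ _ → refl)
    ConvList-choiceSum Ω v (A ∷ F) (C ∷ Cs) =
      CX.ConvList-affine {T = IsChoiceSum Ω (A ∷ F)} (fun Ω A) (λ {χ₁} {χ₂} → extend {χ₁} {χ₂}) C (ConvList-choiceSum Ω v F Cs)
      where
      extend : ∀ {χ₁ χ₂} → χ₁ CX.∈𝒮 CX.gens A → IsChoiceSum Ω F χ₂
             → IsChoiceSum Ω (A ∷ F) (CX.lin ((fun Ω A , χ₁) ∷ (1# , χ₂) ∷ []))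
      extend χ₁∈ (P , ch , χ₂≈P) with find χ₁∈
      ... | g , g∈ , χ₁≈g = (A , g) ∷ P , g∈ ∷ ch ,
        λ x → +-cong (*-congˡ (χ₁≈g x)) (trans (+-identityʳ _) (trans (*-identityˡ _) (χ₂≈P x)))

    -- A generator Ω of 𝒜 together with a choice of generators along support⁺ Ω.
    Index : Set (Level.suc (a ⊔ e ⊔ c ⊔ ℓ))
    Index = FS S Z × List (Zc × FS S X)

    μ-indices : List (FS S Z) → List Index
    μ-indices 𝔊 = concatMap (λ Ω → map (Ω ,_) (choices (support⁺ Ω))) 𝔊

    -- Points with Ω(A) = 0 are left out: c(Ω) does not constrain u(A) there.
    μ-gens : List (FS S Z) → List (FS S X)
    μ-gens 𝔊 = map (λ i → choiceSum (proj₁ i) (proj₂ i)) (μ-indices 𝔊)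

    IsμIndex : List (FS S Z) → Index → Set (Level.suc (a ⊔ e ⊔ c ⊔ ℓ))
    IsμIndex 𝔊 i = proj₁ i ∈ 𝔊 × Choice (support⁺ (proj₁ i)) (proj₂ i)

    ∈μ-indices⁺ : ∀ {𝔊 Ω P} → Ω ∈ 𝔊 → Choice (support⁺ Ω) P → (Ω , P) ∈ μ-indices 𝔊
    ∈μ-indices⁺ Ω∈ ch = Anyₚ.concatMap⁺ _ (Any.map (λ { ≡.refl → Anyₚ.map⁺ (Any.map (≡.cong _) (Choice⇒∈choices ch)) }) Ω∈)

    ∈μ-indices⁻ : ∀ {𝔊 i} → i ∈ μ-indices 𝔊 → IsμIndex 𝔊 i
    ∈μ-indices⁻ {𝔊} i∈ with find (Anyₚ.concatMap⁻ (λ Ω → map (Ω ,_) (choices (support⁺ Ω))) {xs = 𝔊} i∈)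
    ... | Ω , Ω∈ , i∈′ with find (Anyₚ.map⁻ i∈′)
    ... | P , P∈ , ≡.refl = Ω∈ , ∈choices⇒Choice (support⁺ Ω) P∈

    module _ {Ω P} (ch : Choice (support⁺ Ω) P) where

      Choice-distinct : CZ.DistinctKeys proj₁ P
      Choice-distinct = AllPairs.map⁻ (≡.subst (AllPairs _) (≡.sym (Choice-keys ch))
                                               (AllPairs.filter⁺ (nonzero? (fun Ω)) (distinct Ω)))

      choice-pred : ∀ A → Nonzero (fun Ω A) → pred (proj₁ A) (fromTable proj₁ proj₂ P A)
      choice-pred A nz with find (Anyₚ.map⁻ (≡.subst (Any (A ≈Z_)) (≡.sym (Choice-keys ch))
                                   (∈-nonzeros (fun Ω) (λ A≈A′ z → nz (trans (resp Ω A≈A′) z)) (covers Ω A nz))))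
      ... | t , t∈P , A≈t =
        fromTable-pred proj₁ proj₂ P {A} {t} Choice-distinct t∈P A≈t (gens⊆pred (proj₁ t) (All.lookup (Choice-gens ch) t∈P))

      choiceSum-fromTable : ∀ x → fun (choiceSum Ω P) x ≈ CZ.⟪ Ω , (λ A → fun (fromTable proj₁ proj₂ P A) x) ⟫
      choiceSum-fromTable x = begin
        fun (choiceSum Ω P) x
          ≡⟨ ∑-map (λ q → proj₁ q * fun (proj₂ q) x) _ P ⟩
        ∑ (λ t → fun Ω (proj₁ t) * fun (proj₂ t) x) P
          ≈⟨ ∑-congᴬ {L = P} (All.tabulate (λ {t} t∈P → *-congˡ (sym
               (fromTable-∈ proj₁ proj₂ P {proj₁ t} {t} Choice-distinct t∈P (Z.refl {proj₁ t}) x)))) ⟩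
        ∑ (λ t → fun Ω (proj₁ t) * fun (table (proj₁ t)) x) P
          ≡⟨ ∑-map (λ A → fun Ω A * fun (table A) x) proj₁ P ⟨
        ∑ (λ A → fun Ω A * fun (table A) x) (map proj₁ P)
          ≡⟨ ≡.cong (∑ (λ A → fun Ω A * fun (table A) x)) (Choice-keys ch) ⟩
        ∑ (λ A → fun Ω A * fun (table A) x) (support⁺ Ω)
          ≈⟨ ∑-nonzeros (fun Ω) _ (λ _ z → trans (*-congʳ z) (zeroˡ _)) (support Ω) ⟩
        CZ.⟪ Ω , (λ A → fun (table A) x) ⟫ ∎
        where
        table : Zc → FS S X
        table = fromTable proj₁ proj₂ P

    module _ (𝒜 : Setoid.Carrier (𝒞f S Z)) where

      SubGenerator : FS S Z → FS S Z → Set (Level.suc (a ⊔ e ⊔ c ⊔ ℓ))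
      SubGenerator Ω Ω′ = Ω′ ∈ CZ.gens 𝒜 × (∀ A → Nonzero (fun Ω′ A) → Nonzero (fun Ω A))

      subGenerator-decomposition : ∀ {Ω} → pred (proj₁ 𝒜) Ω → CZ.ConvList (SubGenerator Ω) (fun Ω)
      subGenerator-decomposition {Ω} Ω∈𝒜 with CZ.ConvList-representatives id (CZ.fg⇒ConvList 𝒜 Ω∈𝒜)
      ... | L , L∈𝔊 , w≈1 , Ω≈L =
        CZ.ConvList-resp (λ A → sym (Ω≈L A))
          (CZ.ConvList-nonzero L′ (All.tabulate sub) (trans (reflexive (∑-map proj₁ _ L)) w≈1))
        where
        L′ : List (K × FS S Z)
        L′ = map (λ q → proj₁ q , proj₂ q) L
        sub : ∀ {q} → q ∈ L′ → Nonzero (proj₁ q) → SubGenerator Ω (proj₂ q)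
        sub q∈L′ w≉0 = All.lookup (Allₚ.map⁺ L∈𝔊) q∈L′ ,
                       λ A → CZ.combination-support pos sf {Ω} L′ Ω≈L {x = A} q∈L′ w≉0

      module _ {Ω} (Ω∈𝒜 : pred (proj₁ 𝒜) Ω) {u : Zc → FS S X} (u∈ : ∀ A → Nonzero (fun Ω A) → pred (proj₁ A) (u A)) where

        v : Zc → FS S X
        v = fromTable id u (support Ω)

        v∈ : ∀ A → Nonzero (fun Ω A) → pred (proj₁ A) (v A)
        v∈ A nz with find (covers Ω A nz)
        ... | A′ , A′∈ , A≈A′ =
          fromTable-pred id u (support Ω) {A} {A′} (distinct Ω) A′∈ A≈A′ (u∈ A′ (λ z → nz (trans (resp Ω A≈A′) z)))

        vSum : FS S Z → FS S X
        vSum Ω′ = CX.lin (map (λ A → fun Ω′ A , v A) (support⁺ Ω′))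

        vSum-pairing : ∀ Ω′ x → fun (vSum Ω′) x ≈ CZ.⟪ Ω′ , (λ A → fun (v A) x) ⟫
        vSum-pairing Ω′ x = trans (reflexive (∑-map (λ q → proj₁ q * fun (proj₂ q) x) _ (support⁺ Ω′)))
                                 (∑-nonzeros (fun Ω′) _ (λ _ z → trans (*-congʳ z) (zeroˡ _)) (support Ω′))

        vSum∈hull : ∀ {Ω′} → SubGenerator Ω Ω′ → CX.ConvList (CX._∈𝒮 μ-gens (CZ.gens 𝒜)) (fun (vSum Ω′))
        vSum∈hull {Ω′} (Ω′∈𝔊 , Ω′⊆Ω) =
          CX.ConvList-mono (λ (P , ch , χ≈P) → Anyₚ.map⁺ (Any.map (λ { ≡.refl → χ≈P }) (∈μ-indices⁺ Ω′∈𝔊 ch)))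
            (CX.ConvList-resp (λ x → sym (reflexive (∑-map (λ q → proj₁ q * fun (proj₂ q) x) _ (support⁺ Ω′))))
              (ConvList-choiceSum Ω′ v (support⁺ Ω′)
                (nonzeros-All (fun Ω′) (All.universal (λ A nz → CX.fg⇒ConvList A (v∈ A (Ω′⊆Ω A nz))) (support Ω′)))))

        μ-value⇒hull : ∀ {φ : FS S X} → (∀ x → fun φ x ≈ ∑ (λ A → fun Ω A * fun (u A) x) (support Ω))
                     → CX.ConvList (CX._∈𝒮 μ-gens (CZ.gens 𝒜)) (fun φ)
        μ-value⇒hull {φ} φ≈ = CX.ConvList-flatten outer (λ C → C)
          where
          C : CZ.ConvList (SubGenerator Ω) (fun Ω)
          C = subGenerator-decomposition Ω∈𝒜
          vSums : List (K × FS S X)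
          vSums = map (λ q → proj₁ q , vSum (proj₂ q)) (CZ.terms C)
          outer : CX.ConvList (λ χ → CX.ConvList (CX._∈𝒮 μ-gens (CZ.gens 𝒜)) (fun χ)) (fun φ)
          outer = CX.convList vSums (Allₚ.map⁺ (All.map vSum∈hull (CZ.members C)))
            (trans (reflexive (∑-map proj₁ _ (CZ.terms C))) (CZ.weights C))
            (λ x → begin
              fun φ x
                ≈⟨ φ≈ x ⟩
              ∑ (λ A → fun Ω A * fun (u A) x) (support Ω)
                ≈⟨ ∑-congᴬ {L = support Ω} (All.tabulate (λ {A} A∈ → *-congˡ (sym
                     (fromTable-∈ id u (support Ω) {A} {A} (distinct Ω) A∈ (Z.refl {A}) x)))) ⟩
              CZ.⟪ Ω , (λ A → fun (v A) x) ⟫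
                ≈⟨ CZ.⟪⟫-linear {h = λ A → fun (v A) x} (λ {A} {A′} → fromTable-cong id u (support Ω) x {A} {A′})
                                Ω (CZ.terms C) (CZ.value C) ⟩
              ∑ (λ q → proj₁ q * CZ.⟪ proj₂ q , (λ A → fun (v A) x) ⟫) (CZ.terms C)
                ≈⟨ ∑-cong (λ q → *-congˡ (sym (vSum-pairing (proj₂ q) x))) (CZ.terms C) ⟩
              ∑ (λ q → proj₁ q * fun (vSum (proj₂ q)) x) (CZ.terms C)
                ≡⟨ ∑-map (λ q → proj₁ q * fun (proj₂ q) x) _ (CZ.terms C) ⟨
              CX.linComb vSums x ∎)

      μ⊆hull : ∀ φ → MuC S X Z (λ A → pred (proj₁ A)) (proj₁ 𝒜) φ → pred (proj₁ (CX.hull (μ-gens (CZ.gens 𝒜)))) φ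
      μ⊆hull φ (Ω , Ω∈𝒜 , Ψ , (u , u∈ , Ψ=χᵤ) , φ=μΨ) =
        CX.ConvList⇒conv (CX._∈𝒮 μ-gens (CZ.gens 𝒜)) (λ {χ} {χ'} → CX.∈𝒮-resp (μ-gens (CZ.gens 𝒜)) {χ} {χ'}) φ
                         (μ-value⇒hull Ω∈𝒜 u∈ {φ} φ≈)
        where
        φ≈ : ∀ x → fun φ x ≈ ∑ (λ A → fun Ω A * fun (u A) x) (support Ω)
        φ≈ x = trans (φ=μΨ x) (trans (CX.μ-pointMassSum Ψ (CX.choiceTerms Ω u) (CX.SumWhere⇒IsPointMassSum Ω u {Ψ} Ψ=χᵤ) x)
                                     (reflexive (CX.linComb-choiceTerms Ω u x)))

      module _ (D : List (K × Index))
               (D-gen : All (IsμIndex (CZ.gens 𝒜) ∘ proj₂) D)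
               (w≈1 : ∑ proj₁ D ≈ 1#) where

        measure : K × Index → FS S Z
        measure d = proj₁ (proj₂ d)

        table : K × Index → Zc → FS S X
        table d = fromTable proj₁ proj₂ (proj₂ (proj₂ d))

        measures : List (K × FS S Z)
        measures = map (λ d → proj₁ d , measure d) D

        Ωsum : FS S Z
        Ωsum = CZ.lin measures

        Ωsum∈𝒜 : pred (proj₁ 𝒜) Ωsum
        Ωsum∈𝒜 = CZ.ConvList⇒fg 𝒜 (CZ.convList measures (Allₚ.map⁺ (All.map (λ gen → CZ.∈⇒∈𝒮 (proj₁ gen)) D-gen))
                                               (trans (reflexive (∑-map proj₁ _ D)) w≈1) (λ _ → refl))

        termsAt : Zc → List (K × FS S X)
        termsAt A = map (λ d → proj₁ d * fun (measure d) A , table d A) D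

        ∑-termsAt : ∀ A → ∑ proj₁ (termsAt A) ≈ fun Ωsum A
        ∑-termsAt A = reflexive (≡.trans (∑-map proj₁ _ D) (≡.sym (∑-map (λ q → proj₁ q * fun (proj₂ q) A) _ D)))

        -- u(A) = Σ_d w_d Ω_d(A) g^d_A / Ωsum(A)
        u : Zc → FS S X
        u A = CX.barycenter pos sf (termsAt A)

        u∈ : ∀ A → Nonzero (fun Ωsum A) → pred (proj₁ A) (u A)
        u∈ A nz = CX.barycenter-∈ pos sf (proj₁ A) (termsAt A) (λ z → nz (trans (sym (∑-termsAt A)) z))
          (Allₚ.map⁺ (All.map (λ {d} gen wΩ≉0 → choice-pred {measure d} (proj₂ gen) A (nonzero-*⇒nonzeroʳ wΩ≉0)) D-gen))

        Ωsum*u : ∀ A x → fun Ωsum A * fun (u A) x ≈ ∑ (λ d → proj₁ d * (fun (measure d) A * fun (table d A) x)) D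
        Ωsum*u A x = begin
          fun Ωsum A * fun (u A) x                                       ≈⟨ *-congʳ (∑-termsAt A) ⟨
          ∑ proj₁ (termsAt A) * fun (u A) x                            ≈⟨ CX.barycenter-value pos sf (termsAt A) x ⟩
          CX.linComb (termsAt A) x                                     ≡⟨ ∑-map (λ q → proj₁ q * fun (proj₂ q) x) _ D ⟩
          ∑ (λ d → (proj₁ d * fun (measure d) A) * fun (table d A) x) D ≈⟨ ∑-cong (λ d → *-assoc _ _ _) D ⟩
          ∑ (λ d → proj₁ d * (fun (measure d) A * fun (table d A) x)) D ∎

        term-over-supportΩsum : ∀ {d} → d ∈ D → ∀ x → proj₁ d * CZ.⟪ measure d , (λ A → fun (table d A) x) ⟫
                     ≈ ∑ (λ A → proj₁ d * (fun (measure d) A * fun (table d A) x)) (support Ωsum)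
        term-over-supportΩsum {d} d∈D x = trans (sym (∑-*ˡ (proj₁ d) _ (support (measure d))))
          (CZ.∑-support-indep g g-cong (support (measure d)) (support Ωsum) (distinct (measure d)) (distinct Ωsum)
            (λ A nz → covers (measure d) A (nonzero-*⇒nonzeroˡ (nonzero-*⇒nonzeroʳ nz)))
            (λ A nz → covers Ωsum A (λ Ωsum≈0 → nz (trans (sym (*-assoc _ _ _)) (trans (*-congʳ (wΩ≈0 Ωsum≈0)) (zeroˡ _))))))
          where
          g : Zc → K
          g A = proj₁ d * (fun (measure d) A * fun (table d A) x)
          g-cong : Congruent _≈Z_ _≈_ g
          g-cong {A} {A′} A≈A′ = *-congˡ (*-cong (resp (measure d) A≈A′)
                                               (fromTable-cong proj₁ proj₂ (proj₂ (proj₂ d)) x {A} {A′} A≈A′))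
          wΩ≈0 : ∀ {A} → fun Ωsum A ≈ 0# → proj₁ d * fun (measure d) A ≈ 0#
          wΩ≈0 {A} = CZ.combination-zero pos {Ωsum} measures (λ _ → refl) {x = A} (Anyₚ.map⁺ (Any.map (≡.cong _) d∈D))

        φ-value : ∀ {φ : FS S X}
                → (∀ x → fun φ x ≈ CX.linComb (map (λ d → proj₁ d , choiceSum (measure d) (proj₂ (proj₂ d))) D) x)
                → ∀ x → fun φ x ≈ ∑ (λ A → fun Ωsum A * fun (u A) x) (support Ωsum)
        φ-value {φ} φ≈D x = begin
          fun φ x
            ≈⟨ φ≈D x ⟩
          _ ≡⟨ ∑-map (λ q → proj₁ q * fun (proj₂ q) x) _ D ⟩
          ∑ (λ d → proj₁ d * fun (choiceSum (measure d) (proj₂ (proj₂ d))) x) D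
            ≈⟨ ∑-congᴬ {L = D} (All.tabulate (λ {d} d∈D →
                 trans (*-congˡ (choiceSum-fromTable {measure d} (proj₂ (All.lookup D-gen d∈D)) x))
                       (term-over-supportΩsum d∈D x))) ⟩
          ∑ (λ d → ∑ (λ A → proj₁ d * (fun (measure d) A * fun (table d A) x)) (support Ωsum)) D
            ≈⟨ ∑-swap _ D (support Ωsum) ⟩
          ∑ (λ A → ∑ (λ d → proj₁ d * (fun (measure d) A * fun (table d A) x)) D) (support Ωsum)
            ≈⟨ ∑-cong (λ A → sym (Ωsum*u A x)) (support Ωsum) ⟩
          ∑ (λ A → fun Ωsum A * fun (u A) x) (support Ωsum) ∎

      hull⊆μ : ∀ φ → pred (proj₁ (CX.hull (μ-gens (CZ.gens 𝒜)))) φ → MuC S X Z (λ A → pred (proj₁ A)) (proj₁ 𝒜) φ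
      hull⊆μ φ φ∈ with CX.ConvList-representatives (λ i → choiceSum (proj₁ i) (proj₂ i))
                         (CX.ConvList-mono Anyₚ.map⁻ (CX.conv⇒ConvList (CX._∈𝒮 μ-gens (CZ.gens 𝒜)) φ φ∈))
      ... | D , D∈ , w≈1 , φ≈D =
        Ω′ , Ωsum∈𝒜 D D-gen w≈1 , Ψ , (u′ , u∈ D D-gen w≈1 , CX.IsPointMassSum⇒SumWhere Ω′ u′ {Ψ} Ψ-correct) ,
        λ x → trans (φ-value D D-gen w≈1 {φ} φ≈D x)
                    (sym (trans (CX.μ-pointMassSum Ψ (CX.choiceTerms Ω′ u′) Ψ-correct x)
                                (reflexive (CX.linComb-choiceTerms Ω′ u′ x))))
        where
        D-gen : All (IsμIndex (CZ.gens 𝒜) ∘ proj₂) D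
        D-gen = All.map ∈μ-indices⁻ D∈
        Ω′ : FS S Z
        Ω′ = Ωsum D D-gen w≈1
        u′ : Zc → FS S X
        u′ = u D D-gen w≈1
        Ψ : FS S (𝒮 S X)
        Ψ = CX.pointMassSum (CX.choiceTerms Ω′ u′)
        Ψ-correct : CX.IsPointMassSum Ψ (CX.choiceTerms Ω′ u′)
        Ψ-correct = CX.pointMassSum-correct (CX.choiceTerms Ω′ u′)

      μ-hull : ∀ φ → MuC S X Z (λ A → pred (proj₁ A)) (proj₁ 𝒜) φ ⇔ pred (proj₁ (CX.hull (μ-gens (CZ.gens 𝒜)))) φ
      μ-hull φ = mk⇔ (μ⊆hull φ) (hull⊆μ φ)

proposition6p4 : ∀ {c ℓ a e : Level} (S : CommutativeSemiring c ℓ)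
    → IsPositive S → IsSemifield S
    → (∀ {p} → ExcludedMiddle p)
    → (∀ (X Y : Setoid a e) (f : Func X Y) (A : Setoid.Carrier (𝒞f S X))
         → Σ[ B ∈ Setoid.Carrier (𝒞f S Y) ]
             (∀ ψ → CImage S f (proj₁ A) ψ ⇔ pred (proj₁ B) ψ))
    × (∀ (X : Setoid a e) (x : Setoid.Carrier X)
         → Σ[ B ∈ Setoid.Carrier (𝒞f S X) ]
             (∀ φ → IsDelta S X x φ ⇔ pred (proj₁ B) φ))
    × (∀ (X : Setoid a e) (𝒜 : Setoid.Carrier (𝒞f S (𝒞f S X)))
         → Σ[ B ∈ Setoid.Carrier (𝒞f S X) ]
             (∀ φ → MuC S X (𝒞f S X) (λ A → pred (proj₁ A)) (proj₁ 𝒜) φ ⇔ pred (proj₁ B) φ))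
proposition6p4 S pos sf em =
  (λ X Y f A → Convexity.hull Y (map (Pushforward.push f) (Convexity.gens X A)) , Pushforward.push-hull f A) ,
  (λ X x → Convexity.hull X (Convexity.Δ X x ∷ []) , Convexity.Δ-hull X x) ,
  (λ X 𝒜 → Convexity.hull X (Multiplication.μ-gens X pos sf (Convexity.gens (𝒞f S X) 𝒜)) , Multiplication.μ-hull X pos sf 𝒜)
  where open FiniteConvexSets S em
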